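{- Let $F : \mathcal{U}\to\mathcal{U}$ be a small functor and $X : \mathcal{U}$. For all $x,y : FX$, the types $\overline{F}(\mathsf{Path}_X)\,x\,y$ and $\mathsf{Path}_{FX}\,x\,y$ are path equal.
   Context: Setting: cubical type theory (with path types, univalence, universe $\mathcal{U}$), in which paths need not be unique (types need not be sets). A small functor is $F:\mathcal{U}\to\mathcal{U}$ together with an action $F : \Pi X\,Y:\mathcal{U}.\,(X\to Y)\to FX\to FY$ satisfying the identity and composition laws up to path equality. For a relation $R : X \to Y \to \mathcal{U}$, its graph is $\mathsf{tot}\,R = \Sigma x:X.\,\Sigma y:Y.\,R\,x\,y$ with projections $\pi_0, \pi_1$ to $X$ and $Y$, and the relation lifting $\overline{F}R : FX \to FY \to \mathcal{U}$ is $\overline{F}R\,x\,y = \Sigma t : F(\mathsf{tot}\,R).\,\mathsf{Path}_{FX}\,(F\pi_0\,t)\,x \times \mathsf{Path}_{FY}\,(F\pi_1\,t)\,y$. $\mathsf{Path}_X$ is regarded as a relation $X \to X \to \mathcal{U}$. -}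

{-# OPTIONS --without-K #-}
module Defs where

open import Level using (Level; _⊔_)
open import Data.Product using (Σ; _×_; _,_; proj₁; proj₂)
open import Relation.Binary.PropositionalEquality using (_≡_; refl)

-- The universe 𝒰 is Set; Path_X is the identity type _≡_ (under --without-K,
-- so paths need not be unique).

isContr : ∀ {ℓ} → Set ℓ → Set ℓ
isContr A = Σ A λ a → ∀ b → a ≡ b

fiber : ∀ {ℓ ℓ'} {A : Set ℓ} {B : Set ℓ'} → (A → B) → B → Set (ℓ ⊔ ℓ')
fiber {A = A} f b = Σ A λ a → f a ≡ b

isEquiv : ∀ {ℓ ℓ'} {A : Set ℓ} {B : Set ℓ'} → (A → B) → Set _
isEquiv {B = B} f = ∀ b → isContr (fiber f b)

_≃_ : ∀ {ℓ ℓ'} → Set ℓ → Set ℓ' → Set _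
A ≃ B = Σ (A → B) isEquiv

idEquiv : ∀ {ℓ} (A : Set ℓ) → A ≃ A
idEquiv A = (λ a → a) , λ b → (b , refl) , λ { (a , refl) → refl }

idToEquiv : ∀ {ℓ} {A B : Set ℓ} → A ≡ B → A ≃ B
idToEquiv {A = A} refl = idEquiv A

Univalence : Set₁
Univalence = ∀ {A B : Set} → isEquiv (idToEquiv {A = A} {B = B})

Rel : Set → Set → Set₁
Rel X Y = X → Y → Set

PathRel : (X : Set) → Rel X X
PathRel X = _≡_

record SmallFunctor : Set₁ where
  field
    F₀ : Set → Set
    F₁ : ∀ {X Y : Set} → (X → Y) → F₀ X → F₀ Y
    F-id : ∀ {X : Set} → F₁ {X} {X} (λ x → x) ≡ (λ x → x)
    F-∘ : ∀ {X Y Z : Set} (f : X → Y) (g : Y → Z) →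
          F₁ (λ x → g (f x)) ≡ (λ x → F₁ g (F₁ f x))

tot : {X Y : Set} → Rel X Y → Set
tot {X} {Y} R = Σ X λ x → Σ Y λ y → R x y

π₀ : {X Y : Set} {R : Rel X Y} → tot R → X
π₀ (x , _ , _) = x

π₁ : {X Y : Set} {R : Rel X Y} → tot R → Y
π₁ (_ , y , _) = y

lift : (F : SmallFunctor) {X Y : Set} → Rel X Y →
       Rel (SmallFunctor.F₀ F X) (SmallFunctor.F₀ F Y)
lift F {X} {Y} R x y =
  Σ (F₀ (tot R)) λ t → (F₁ (π₀ {R = R}) t ≡ x) × (F₁ (π₁ {R = R}) t ≡ y)
  where open SmallFunctor F

{-# OPTIONS --without-K #-}
-- The projection π₀ out of the graph of Path_X is an equivalence (singletons
-- are contractible), and its inverse x ↦ (x , x , refl) is also a section of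
-- π₁; by univalence this forces π₀ ≡ π₁ as functions. So F̄(Path_X) x y is
-- Σ t. (F π₀ t ≡ x) × (F π₀ t ≡ y), and transporting along the path
-- tot Path_X ≡ X induced by π₀ (where F π₀ becomes F id = id) turns it into
-- Σ t. (t ≡ x) × (t ≡ y), which is equivalent to x ≡ y.
module Submission where

open import Defs
open import Function using (_∘_; id)
open import Relation.Binary.PropositionalEquality
  using (_≡_; refl; sym; trans; cong; subst; module ≡-Reasoning)
open import Data.Product using (Σ; _×_; _,_; proj₁; proj₂)

coe : {A B : Set} → A ≡ B → A → B
coe p = proj₁ (idToEquiv p)

coe-postcomp-injective : {A B C : Set} (p : A ≡ B) {f g : C → A} →
  coe p ∘ f ≡ coe p ∘ g → f ≡ g
coe-postcomp-injective refl eq = eq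

module _ (univalence : Univalence) where

  ua : {A B : Set} → A ≃ B → A ≡ B
  ua e = proj₁ (proj₁ (univalence e))

  coe-ua : {A B : Set} (e : A ≃ B) → coe (ua e) ≡ proj₁ e
  coe-ua e = cong proj₁ (proj₂ (proj₁ (univalence e)))

  ≃-postcomp-injective : {A B C : Set} (e : A ≃ B) {f g : C → A} →
    proj₁ e ∘ f ≡ proj₁ e ∘ g → f ≡ g
  ≃-postcomp-injective e {f} {g} eq =
    coe-postcomp-injective (ua e) (subst (λ h → h ∘ f ≡ h ∘ g) (sym (coe-ua e)) eq)

  section-of-≃-is-retraction : {A B : Set} (e : A ≃ B) (s : B → A) →
    proj₁ e ∘ s ≡ id → s ∘ proj₁ e ≡ id
  section-of-≃-is-retraction e s sec = ≃-postcomp-injective e (cong (_∘ proj₁ e) sec)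

module _ {X : Set} where

  diag : X → tot (PathRel X)
  diag x = x , x , refl

  π₀-isEquiv : isEquiv (π₀ {R = PathRel X})
  π₀-isEquiv x = (diag x , refl) , λ { ((_ , _ , refl) , refl) → refl }

  π₀-≃ : tot (PathRel X) ≃ X
  π₀-≃ = π₀ , π₀-isEquiv

  π₀≡π₁ : Univalence → π₀ {R = PathRel X} ≡ π₁
  π₀≡π₁ u = cong (π₁ ∘_) (section-of-≃-is-retraction u π₀-≃ diag refl)

common-source≃path : {Y : Set} (x y : Y) → (Σ Y λ t → (t ≡ x) × (t ≡ y)) ≃ (x ≡ y)
common-source≃path {Y} x y =
  join , λ r → ((x , refl , r) , refl) , λ { ((_ , refl , _) , refl) → refl }
  where
  join : (Σ Y λ t → (t ≡ x) × (t ≡ y)) → x ≡ y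
  join (_ , p , q) = trans (sym p) q

module _ (F : SmallFunctor) where
  open SmallFunctor F

  Σ-F₁-coe : {A X : Set} (p : A ≡ X) (P : F₀ X → Set) →
    Σ (F₀ A) (P ∘ F₁ (coe p)) ≡ Σ (F₀ X) P
  Σ-F₁-coe refl P = cong (λ h → Σ _ (P ∘ h)) F-id

proposition6p1 : Univalence → (F : SmallFunctor) (X : Set) →
    (x y : SmallFunctor.F₀ F X) → lift F (PathRel X) x y ≡ PathRel (SmallFunctor.F₀ F X) x y
proposition6p1 u F X x y = begin
  lift F (PathRel X) x y
    ≡⟨ cong (λ k → Σ _ λ t → (F₁ π₀ t ≡ x) × (F₁ k t ≡ y)) (sym (π₀≡π₁ u)) ⟩
  Σ _ (Span ∘ F₁ π₀)
    ≡⟨ cong (λ h → Σ _ (Span ∘ F₁ h)) (sym (coe-ua u π₀-≃)) ⟩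
  Σ _ (Span ∘ F₁ (coe (ua u π₀-≃)))
    ≡⟨ Σ-F₁-coe F (ua u π₀-≃) Span ⟩
  Σ (F₀ X) Span
    ≡⟨ ua u (common-source≃path x y) ⟩
  x ≡ y ∎
  where
  open SmallFunctor F
  open ≡-Reasoning
  Span : F₀ X → Set
  Span t = (t ≡ x) × (t ≡ y)
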